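{- Let $G$ be a finite simple graph and let $\hat G$ be the graph obtained from $G$ by the following procedure: set $\hat G:=G$; while $\hat G$ has a leaf $u$ (with neighbor $v$), replace $\hat G$ by $\hat G-\{u,v\}$; then output $\hat G$ (so $\hat G$ has no vertex of degree one, or has no vertices). Then (i) $Z^-(G)=Z^-(\hat G)$, and (ii) $Z^-(G)=0$ if and only if $\hat G$ is the graph with no vertices.
   Context: Skew zero forcing: initially some set of vertices is colored blue and the rest white; the rule is: if $w$ is the only white neighbor of any vertex $u$ (blue or white), then $u$ may color $w$ blue. A skew zero forcing set is an initial blue set from which repeated application can make all vertices blue; $Z^-(G)$ is the minimum cardinality of a skew zero forcing set. A leaf is a vertex of degree one. $G-S$ denotes the subgraph induced by $V(G)\setminus S$. By convention $Z^-$ of the graph with no vertices is $0$. The choice of leaf at each iteration is arbitrary; the statement holds for any output of the procedure. -}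

module Defs where

open import Data.Nat using (ℕ; _≤_)
open import Data.Fin using (Fin)
open import Data.Fin.Subset public
  using (Subset; _∈_; _∉_; _⊆_; _∪_; _─_; ⁅_⁆; ∣_∣; ⊤; Empty)
open import Data.Product using (Σ; ∃; _×_)
open import Relation.Nullary using (¬_)
open import Relation.Binary using (Decidable)
open import Relation.Binary.PropositionalEquality using (_≡_)
open import Relation.Binary.Construct.Closure.ReflexiveTransitive
  using (Star) public
open import Function.Bundles using (_⇔_) public

record Graph (n : ℕ) : Set₁ where
  field
    Adj    : Fin n → Fin n → Set
    adj?   : Decidable Adj
    sym    : ∀ {u v} → Adj u v → Adj v u
    irrefl : ∀ {u} → ¬ Adj u u
open Graph public

module _ {n : ℕ} (G : Graph n) where

  -- Induced subgraphs G[W] are represented by their vertex set W ⊆ V(G).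

  IsLeaf : Subset n → Fin n → Fin n → Set
  IsLeaf W u v = u ∈ W × v ∈ W × Adj G u v ×
                 (∀ x → x ∈ W → Adj G u x → x ≡ v)

  HasLeaf : Subset n → Set
  HasLeaf W = Σ (Fin n) λ u → Σ (Fin n) λ v → IsLeaf W u v

  LeafStep : Subset n → Subset n → Set
  LeafStep W W' = Σ (Fin n) λ u → Σ (Fin n) λ v →
                  IsLeaf W u v × W' ≡ W ─ (⁅ u ⁆ ∪ ⁅ v ⁆)

  -- Skew forcing rule in G[W] with blue set B: u (any vertex of G[W])
  -- forces w, w being the only white neighbour of u in G[W].
  SkewForce : Subset n → Subset n → Fin n → Fin n → Set
  SkewForce W B u w = u ∈ W × w ∈ W × Adj G u w × w ∉ B ×
                      (∀ x → x ∈ W → Adj G u x → x ∉ B → x ≡ w)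

  data Colours (W : Subset n) : Subset n → Set where
    done  : ∀ {B} → W ⊆ B → Colours W B
    force : ∀ {B} u w → SkewForce W B u w → Colours W (B ∪ ⁅ w ⁆) →
            Colours W B

  IsSkewZFS : Subset n → Subset n → Set
  IsSkewZFS W B = B ⊆ W × Colours W B

  SkewZ≡ : Subset n → ℕ → Set
  SkewZ≡ W k = (Σ (Subset n) λ B → IsSkewZFS W B × ∣ B ∣ ≡ k) ×
               (∀ B → IsSkewZFS W B → k ≤ ∣ B ∣)

-- Deleting a leaf u together with its neighbour v leaves Z⁻ unchanged. A skew
-- forcing set of G - {u, v} is one of G: u forces v, the forcing of G - {u, v}
-- runs unchanged because u has no neighbour there, and finally v forces u.
-- Conversely, a skew forcing process of G restricts to G - {u, v} except for the
-- forces made by v. After v forces, all its neighbours are blue, so v forces into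
-- G - {u, v} at most once, and then u is already blue; trading u for that vertex
-- gives a skew forcing set of G - {u, v} that is no larger. Iterating gives (i).
-- For (ii): with nothing blue, the first force is made by a vertex whose only
-- neighbour is the forced vertex, i.e. by a leaf.
module Submission where

open import Defs
open import Data.Nat using (ℕ; suc; _+_; _≤_; z≤n; s≤s)
open import Data.Nat.Properties using (≤-trans; ≤-antisym; +-monoʳ-≤; +-suc; +-comm; module ≤-Reasoning)
open import Data.Fin using (Fin)
open import Data.Fin.Subset using (Subset; Nonempty; _∩_; _-_; ⊥; inside; outside)
open import Data.Fin.Subset.Properties
  using (_∈?_; x∈p∪q⁻; x∈p∪q⁺; p⊆p∪q; q⊆p∪q; x∈p∩q⁺; x∈p∩q⁻; x∈⁅x⁆; x∈⁅y⁆⇒x≡y;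
         x∈p∧x∉q⇒x∈p─q; p─q⊆p; x∈p∧x≢y⇒x∈p-y; x∈p⇒∣p-x∣<∣p∣; ∣p∣≤∣x∷p∣;
         ∣p∩q∣≤∣p∣; p∩q⊆q; p⊆q⇒∣p∣≤∣q∣; ∣⁅x⁆∣≡1; ∉⊥; ∣⊥∣≡0; ⊆-trans)
open import Data.Vec using ([]; _∷_; here; there)
open import Data.Product using (Σ; _×_; _,_; proj₁; proj₂)
open import Data.Sum using (_⊎_; inj₁; inj₂)
import Data.Sum
open import Data.Empty using (⊥-elim)
open import Relation.Nullary using (¬_; yes; no)
open import Relation.Nullary.Decidable using (decidable-stable)
open import Relation.Binary.PropositionalEquality using (_≡_; _≢_; refl; cong; subst)
  renaming (sym to ≡-sym)
import Relation.Binary.Construct.Closure.ReflexiveTransitive as Star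
open import Function.Bundles using (mk⇔)
import Function.Properties.Equivalence as ⇔

private
  variable
    n : ℕ
    x y z : Fin n
    p q r : Subset n

∪-⊆ : p ⊆ r → q ⊆ r → p ∪ q ⊆ r
∪-⊆ {p = p} {q = q} p⊆r q⊆r y∈p∪q with x∈p∪q⁻ p q y∈p∪q
... | inj₁ y∈p = p⊆r y∈p
... | inj₂ y∈q = q⊆r y∈q

∪⁅x⁆-mono : p ⊆ q → p ∪ ⁅ x ⁆ ⊆ q ∪ ⁅ x ⁆
∪⁅x⁆-mono {q = q} {x = x} p⊆q = ∪-⊆ (λ h → p⊆p∪q ⁅ x ⁆ (p⊆q h)) (q⊆p∪q q ⁅ x ⁆)

x∈p⇒⁅x⁆⊆p : x ∈ p → ⁅ x ⁆ ⊆ p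
x∈p⇒⁅x⁆⊆p {x = x} x∈p y∈⁅x⁆ = subst (_∈ _) (≡-sym (x∈⁅y⁆⇒x≡y x y∈⁅x⁆)) x∈p

x∈p─q⇒x∉q : x ∈ p ─ q → x ∉ q
x∈p─q⇒x∉q {p = _ ∷ _} {q = inside ∷ _}  ()        here
x∈p─q⇒x∉q {p = _ ∷ _} {q = _ ∷ _}       (there h) (there h') = x∈p─q⇒x∉q h h'

∣p∪q∣≤∣p∣+∣q∣ : (p q : Subset n) → ∣ p ∪ q ∣ ≤ ∣ p ∣ + ∣ q ∣
∣p∪q∣≤∣p∣+∣q∣ []            []            = z≤n
∣p∪q∣≤∣p∣+∣q∣ (inside ∷ p)  (s ∷ q)       =
  s≤s (≤-trans (∣p∪q∣≤∣p∣+∣q∣ p q) (+-monoʳ-≤ ∣ p ∣ (∣p∣≤∣x∷p∣ s q)))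
∣p∪q∣≤∣p∣+∣q∣ (outside ∷ p) (inside ∷ q)  rewrite +-suc ∣ p ∣ ∣ q ∣ = s≤s (∣p∪q∣≤∣p∣+∣q∣ p q)
∣p∪q∣≤∣p∣+∣q∣ (outside ∷ p) (outside ∷ q) = ∣p∪q∣≤∣p∣+∣q∣ p q

∣p∪⁅x⁆∣≤1+∣p∣ : (p : Subset n) (x : Fin n) → ∣ p ∪ ⁅ x ⁆ ∣ ≤ suc ∣ p ∣
∣p∪⁅x⁆∣≤1+∣p∣ p x = begin
  ∣ p ∪ ⁅ x ⁆ ∣      ≤⟨ ∣p∪q∣≤∣p∣+∣q∣ p ⁅ x ⁆ ⟩
  ∣ p ∣ + ∣ ⁅ x ⁆ ∣  ≡⟨ cong (∣ p ∣ +_) (∣⁅x⁆∣≡1 x) ⟩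
  ∣ p ∣ + 1          ≡⟨ +-comm ∣ p ∣ 1 ⟩
  suc ∣ p ∣          ∎
  where open ≤-Reasoning

∣p∣≡0⇒x∉p : ∣ p ∣ ≡ 0 → x ∉ p
∣p∣≡0⇒x∉p {p = p} {x = x} ∣p∣≡0 x∈p
  with subst (1 ≤_) ∣p∣≡0 (subst (_≤ ∣ p ∣) (∣⁅x⁆∣≡1 x) (p⊆q⇒∣p∣≤∣q∣ (x∈p⇒⁅x⁆⊆p x∈p)))
... | ()

∪⁅x⁆∩⊆∩∪⁅x⁆ : (p ∪ ⁅ x ⁆) ∩ r ⊆ (p ∩ r) ∪ ⁅ x ⁆
∪⁅x⁆∩⊆∩∪⁅x⁆ {p = p} {x = x} {r = r} y∈ with x∈p∩q⁻ (p ∪ ⁅ x ⁆) r y∈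
... | y∈p∪x , y∈r with x∈p∪q⁻ p ⁅ x ⁆ y∈p∪x
...   | inj₁ y∈p = x∈p∪q⁺ (inj₁ (x∈p∩q⁺ (y∈p , y∈r)))
...   | inj₂ y∈x = x∈p∪q⁺ (inj₂ y∈x)

x∉r⇒∪⁅x⁆∩⊆∩ : x ∉ r → (p ∪ ⁅ x ⁆) ∩ r ⊆ p ∩ r
x∉r⇒∪⁅x⁆∩⊆∩ {x = x} {r = r} {p = p} x∉r y∈ with x∈p∪q⁻ (p ∩ r) ⁅ x ⁆ (∪⁅x⁆∩⊆∩∪⁅x⁆ y∈)
... | inj₁ y∈p∩r = y∈p∩r
... | inj₂ y∈x   = ⊥-elim (x∉r (subst (_∈ r) (x∈⁅y⁆⇒x≡y x y∈x) (proj₂ (x∈p∩q⁻ (p ∪ ⁅ x ⁆) r y∈))))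

x∈p∪⁅y⁆∧x≢y⇒x∈p : x ∈ p ∪ ⁅ y ⁆ → x ≢ y → x ∈ p
x∈p∪⁅y⁆∧x≢y⇒x∈p {p = p} {y = y} x∈p∪y x≢y with x∈p∪q⁻ p ⁅ y ⁆ x∈p∪y
... | inj₁ x∈p = x∈p
... | inj₂ x∈y = ⊥-elim (x≢y (x∈⁅y⁆⇒x≡y y x∈y))

[x∉p⇒x≡y]⇒x∈p∪⁅y⁆ : (x ∉ p → x ≡ y) → x ∈ p ∪ ⁅ y ⁆
[x∉p⇒x≡y]⇒x∈p∪⁅y⁆ {x = x} {p = p} {y = y} white⇒≡y with x ∈? p
... | yes x∈p = p⊆p∪q ⁅ y ⁆ x∈p
... | no  x∉p = subst (_∈ p ∪ ⁅ y ⁆) (≡-sym (white⇒≡y x∉p)) (q⊆p∪q p ⁅ y ⁆ (x∈⁅x⁆ y))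

∪⁅x⁆∪⁅y⁆⊆∪⁅y⁆∪⁅x⁆ : (p ∪ ⁅ x ⁆) ∪ ⁅ y ⁆ ⊆ (p ∪ ⁅ y ⁆) ∪ ⁅ x ⁆
∪⁅x⁆∪⁅y⁆⊆∪⁅y⁆∪⁅x⁆ {p = p} {x = x} {y = y} =
  ∪-⊆ (∪-⊆ (λ h → p⊆p∪q ⁅ x ⁆ (p⊆p∪q ⁅ y ⁆ h)) (q⊆p∪q (p ∪ ⁅ y ⁆) ⁅ x ⁆))
      (λ h → p⊆p∪q ⁅ x ⁆ (q⊆p∪q p ⁅ y ⁆ h))

module Forcing {n : ℕ} (G : Graph n) where

  private
    variable
      W B B' : Subset n

  SoleWhiteNeighbour : Subset n → Subset n → Fin n → Fin n → Set
  SoleWhiteNeighbour W B x z = ∀ y → y ∈ W → Adj G x y → y ∉ B → y ≡ z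

  NeighboursBlue : Subset n → Subset n → Fin n → Set
  NeighboursBlue W B x = ∀ y → y ∈ W → Adj G x y → y ∈ B

  SoleWhiteNeighbour-mono : B ⊆ B' → SoleWhiteNeighbour W B x z → SoleWhiteNeighbour W B' x z
  SoleWhiteNeighbour-mono B⊆B' sole y y∈W x~y y∉B' = sole y y∈W x~y (λ y∈B → y∉B' (B⊆B' y∈B))

  SoleWhiteNeighbour-restrict : ∀ {V} → V ⊆ W →
    SoleWhiteNeighbour W B x z → SoleWhiteNeighbour V (B ∩ V) x z
  SoleWhiteNeighbour-restrict V⊆W sole y y∈V x~y y∉B∩V =
    sole y (V⊆W y∈V) x~y (λ y∈B → y∉B∩V (x∈p∩q⁺ (y∈B , y∈V)))

  SoleWhiteNeighbour⇒NeighboursBlue : SoleWhiteNeighbour W B x z → NeighboursBlue W (B ∪ ⁅ z ⁆) x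
  SoleWhiteNeighbour⇒NeighboursBlue sole y y∈W x~y = [x∉p⇒x≡y]⇒x∈p∪⁅y⁆ (sole y y∈W x~y)

  NeighboursBlue-mono : B ⊆ B' → NeighboursBlue W B x → NeighboursBlue W B' x
  NeighboursBlue-mono B⊆B' blue y y∈W x~y = B⊆B' (blue y y∈W x~y)

  Colours-mono : Colours G W B → B ⊆ B' → Colours G W B'
  Colours-mono (done W⊆B) B⊆B' = done (λ h → B⊆B' (W⊆B h))
  Colours-mono {B' = B'} (force x w (x∈W , w∈W , x~w , _ , sole) rest) B⊆B' with w ∈? B'
  ... | yes w∈B' = Colours-mono rest (∪-⊆ B⊆B' (x∈p⇒⁅x⁆⊆p w∈B'))
  ... | no  w∉B' = force x w (x∈W , w∈W , x~w , w∉B' , SoleWhiteNeighbour-mono B⊆B' sole)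
                         (Colours-mono rest (∪⁅x⁆-mono B⊆B'))

  Colours-force : x ∈ W → z ∈ W → Adj G x z → SoleWhiteNeighbour W B x z →
                  Colours G W (B ∪ ⁅ z ⁆) → Colours G W B
  Colours-force {x = x} {z = z} {B = B} x∈W z∈W x~z sole rest with z ∈? B
  ... | yes z∈B = Colours-mono rest (∪-⊆ (λ h → h) (x∈p⇒⁅x⁆⊆p z∈B))
  ... | no  z∉B = force x z (x∈W , z∈W , x~z , z∉B , sole) rest

module LeafDeletion {n : ℕ} (G : Graph n) {W : Subset n} {u v : Fin n}
                    (leaf : IsLeaf G W u v) where

  open Forcing G

  private
    variable
      B C D : Subset n

  H : Subset n
  H = W ─ (⁅ u ⁆ ∪ ⁅ v ⁆)

  u∈W : u ∈ W
  u∈W = proj₁ leaf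

  v∈W : v ∈ W
  v∈W = proj₁ (proj₂ leaf)

  u~v : Adj G u v
  u~v = proj₁ (proj₂ (proj₂ leaf))

  neighbour-of-u : ∀ y → y ∈ W → Adj G u y → y ≡ v
  neighbour-of-u = proj₂ (proj₂ (proj₂ leaf))

  v≢u : v ≢ u
  v≢u refl = irrefl G u~v

  H⊆W : H ⊆ W
  H⊆W = p─q⊆p W (⁅ u ⁆ ∪ ⁅ v ⁆)

  u∉H : u ∉ H
  u∉H u∈H = x∈p─q⇒x∉q u∈H (p⊆p∪q ⁅ v ⁆ (x∈⁅x⁆ u))

  v∉H : v ∉ H
  v∉H v∈H = x∈p─q⇒x∉q v∈H (q⊆p∪q ⁅ u ⁆ ⁅ v ⁆ (x∈⁅x⁆ v))

  ∈H⇒≢u : x ∈ H → x ≢ u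
  ∈H⇒≢u x∈H refl = u∉H x∈H

  ∉H⇒≡u⊎≡v : x ∈ W → x ∉ H → x ≡ u ⊎ x ≡ v
  ∉H⇒≡u⊎≡v {x = x} x∈W x∉H with x ∈? (⁅ u ⁆ ∪ ⁅ v ⁆)
  ... | yes x∈uv = Data.Sum.map (x∈⁅y⁆⇒x≡y u) (x∈⁅y⁆⇒x≡y v) (x∈p∪q⁻ ⁅ u ⁆ ⁅ v ⁆ x∈uv)
  ... | no  x∉uv = ⊥-elim (x∉H (x∈p∧x∉q⇒x∈p─q x∈W x∉uv))

  H-≁-u : x ∈ H → ¬ Adj G x u
  H-≁-u x∈H x~u = v∉H (subst (_∈ H) (neighbour-of-u _ (H⊆W x∈H) (sym G x~u)) x∈H)

  ∉H-neighbour-of-H⇒≡v : x ∈ W → x ∉ H → Adj G x z → z ∈ H → x ≡ v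
  ∉H-neighbour-of-H⇒≡v x∈W x∉H x~z z∈H with ∉H⇒≡u⊎≡v x∈W x∉H
  ... | inj₁ refl = ⊥-elim (H-≁-u z∈H (sym G x~z))
  ... | inj₂ x≡v  = x≡v

  ∉H∧∉D⇒≡u : v ∈ D → y ∈ W → y ∉ H → y ∉ D → y ≡ u
  ∉H∧∉D⇒≡u v∈D y∈W y∉H y∉D with ∉H⇒≡u⊎≡v y∈W y∉H
  ... | inj₁ y≡u  = y≡u
  ... | inj₂ refl = ⊥-elim (y∉D v∈D)

  Colours-lift : Colours G H C → C ⊆ D → v ∈ D → Colours G W D
  Colours-lift {D = D} (done H⊆C) C⊆D v∈D =
    Colours-force v∈W u∈W (sym G u~v) (λ y y∈W _ → only-u-white y∈W)
      (done (λ y∈W → [x∉p⇒x≡y]⇒x∈p∪⁅y⁆ (only-u-white y∈W)))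
    where
    only-u-white : y ∈ W → y ∉ D → y ≡ u
    only-u-white {y} y∈W y∉D with y ∈? H
    ... | yes y∈H = ⊥-elim (y∉D (C⊆D (H⊆C y∈H)))
    ... | no  y∉H = ∉H∧∉D⇒≡u v∈D y∈W y∉H y∉D
  Colours-lift {D = D} (force x w (x∈H , w∈H , x~w , _ , sole) rest) C⊆D v∈D =
    Colours-force (H⊆W x∈H) (H⊆W w∈H) x~w sole-in-W
      (Colours-lift rest (∪⁅x⁆-mono C⊆D) (p⊆p∪q ⁅ w ⁆ v∈D))
    where
    sole-in-W : SoleWhiteNeighbour W D x w
    sole-in-W y y∈W x~y y∉D with y ∈? H
    ... | yes y∈H = sole y y∈H x~y (λ y∈C → y∉D (C⊆D y∈C))
    ... | no  y∉H = ⊥-elim (H-≁-u x∈H (subst (Adj G x) (∉H∧∉D⇒≡u v∈D y∈W y∉H y∉D) x~y))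

  -- u forces v first; the forcing of H then runs in G[W] because u is not adjacent to H.
  skewZFS-lift : IsSkewZFS G H B → IsSkewZFS G W B
  skewZFS-lift {B = B} (B⊆H , colours) =
    (λ b∈B → H⊆W (B⊆H b∈B)) ,
    Colours-force u∈W v∈W u~v (λ y y∈W u~y _ → neighbour-of-u y y∈W u~y)
      (Colours-lift colours (p⊆p∪q ⁅ v ⁆) (q⊆p∪q B ⁅ v ⁆ (x∈⁅x⁆ v)))

  Colours-restrict-done : W ⊆ D → Colours G H (D ∩ H)
  Colours-restrict-done W⊆D = done (λ y∈H → x∈p∩q⁺ (W⊆D (H⊆W y∈H) , y∈H))

  -- Once every neighbour of v is blue, v never forces again, so the forcing
  -- of G[W] restricts to one of G[H].
  Colours-restrict-saturated : Colours G W D → NeighboursBlue W D v → Colours G H (D ∩ H)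
  Colours-restrict-saturated (done W⊆D) _ = Colours-restrict-done W⊆D
  Colours-restrict-saturated (force x z (x∈W , z∈W , x~z , z∉D , sole) rest) v-blue
    with Colours-restrict-saturated rest (NeighboursBlue-mono (p⊆p∪q ⁅ z ⁆) v-blue)
       | z ∈? H
  ... | colours | no  z∉H = Colours-mono colours (x∉r⇒∪⁅x⁆∩⊆∩ z∉H)
  ... | colours | yes z∈H with x ∈? H
  ...   | yes x∈H = Colours-force x∈H z∈H x~z (SoleWhiteNeighbour-restrict H⊆W sole)
                      (Colours-mono colours ∪⁅x⁆∩⊆∩∪⁅x⁆)
  ...   | no  x∉H with ∉H-neighbour-of-H⇒≡v x∈W x∉H x~z z∈H
  ...     | refl = ⊥-elim (z∉D (v-blue z z∈W x~z))

  -- The restriction of a forcing of G[W] to G[H] needs at most one extra blue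
  -- vertex, namely the one forced by v, and it is needed only when u is blue.
  Restricted : Subset n → Set
  Restricted D = Colours G H (D ∩ H) ⊎
                 (u ∈ D × Σ (Fin n) λ w → w ∈ H × Colours G H ((D ∩ H) ∪ ⁅ w ⁆))

  Restricted-skip : z ∉ H → z ≢ u → Restricted (D ∪ ⁅ z ⁆) → Restricted D
  Restricted-skip z∉H _ (inj₁ colours) = inj₁ (Colours-mono colours (x∉r⇒∪⁅x⁆∩⊆∩ z∉H))
  Restricted-skip z∉H z≢u (inj₂ (u∈D∪z , w , w∈H , colours)) =
    inj₂ (x∈p∪⁅y⁆∧x≢y⇒x∈p u∈D∪z (λ u≡z → z≢u (≡-sym u≡z)) , w , w∈H ,
          Colours-mono colours (∪⁅x⁆-mono (x∉r⇒∪⁅x⁆∩⊆∩ z∉H)))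

  Restricted-force : x ∈ H → z ∈ H → Adj G x z → SoleWhiteNeighbour H (D ∩ H) x z →
                     Restricted (D ∪ ⁅ z ⁆) → Restricted D
  Restricted-force x∈H z∈H x~z sole (inj₁ colours) =
    inj₁ (Colours-force x∈H z∈H x~z sole (Colours-mono colours ∪⁅x⁆∩⊆∩∪⁅x⁆))
  Restricted-force x∈H z∈H x~z sole (inj₂ (u∈D∪z , w , w∈H , colours)) =
    inj₂ (x∈p∪⁅y⁆∧x≢y⇒x∈p u∈D∪z (λ u≡z → ∈H⇒≢u z∈H (≡-sym u≡z)) , w , w∈H ,
          Colours-force x∈H z∈H x~z (SoleWhiteNeighbour-mono (p⊆p∪q ⁅ w ⁆) sole)
            (Colours-mono colours (⊆-trans (∪⁅x⁆-mono ∪⁅x⁆∩⊆∩∪⁅x⁆) ∪⁅x⁆∪⁅y⁆⊆∪⁅y⁆∪⁅x⁆)))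

  u∈D-when-v-forces-H : SoleWhiteNeighbour W D v z → z ∈ H → u ∈ D
  u∈D-when-v-forces-H {D = D} sole z∈H = decidable-stable (u ∈? D)
    (λ u∉D → ∈H⇒≢u z∈H (≡-sym (sole u u∈W (sym G u~v) u∉D)))

  Restricted-by-v : SoleWhiteNeighbour W D v z → Colours G W (D ∪ ⁅ z ⁆) → Restricted D
  Restricted-by-v {z = z} sole rest
    with Colours-restrict-saturated rest (SoleWhiteNeighbour⇒NeighboursBlue sole) | z ∈? H
  ... | colours | yes z∈H =
    inj₂ (u∈D-when-v-forces-H sole z∈H , z , z∈H , Colours-mono colours ∪⁅x⁆∩⊆∩∪⁅x⁆)
  ... | colours | no  z∉H = inj₁ (Colours-mono colours (x∉r⇒∪⁅x⁆∩⊆∩ z∉H))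

  Colours-restrict : Colours G W D → Restricted D
  Colours-restrict (done W⊆D) = inj₁ (Colours-restrict-done W⊆D)
  Colours-restrict (force x z (x∈W , z∈W , x~z , _ , sole) rest) with x ∈? H
  ... | yes x∈H with z ∈? H
  ...   | yes z∈H = Restricted-force x∈H z∈H x~z (SoleWhiteNeighbour-restrict H⊆W sole)
                      (Colours-restrict rest)
  ...   | no  z∉H = Restricted-skip z∉H (λ { refl → H-≁-u x∈H x~z }) (Colours-restrict rest)
  Colours-restrict (force x z (x∈W , z∈W , x~z , _ , sole) rest) | no x∉H
    with ∉H⇒≡u⊎≡v x∈W x∉H
  ... | inj₂ refl = Restricted-by-v sole rest
  ... | inj₁ refl with neighbour-of-u z z∈W x~z
  ...   | refl = Restricted-skip v∉H v≢u (Colours-restrict rest)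

  skewZFS-restrict : IsSkewZFS G W B → Σ (Subset n) λ B' → IsSkewZFS G H B' × ∣ B' ∣ ≤ ∣ B ∣
  skewZFS-restrict {B = B} (_ , colours) with Colours-restrict colours
  ... | inj₁ colours-H = B ∩ H , (p∩q⊆q B H , colours-H) , ∣p∩q∣≤∣p∣ B H
  ... | inj₂ (u∈B , w , w∈H , colours-H) =
    (B ∩ H) ∪ ⁅ w ⁆ , (∪-⊆ (p∩q⊆q B H) (x∈p⇒⁅x⁆⊆p w∈H) , colours-H) , size
    where
    open ≤-Reasoning
    B∩H⊆B-u : B ∩ H ⊆ B - u
    B∩H⊆B-u y∈B∩H with x∈p∩q⁻ B H y∈B∩H
    ... | y∈B , y∈H = x∈p∧x≢y⇒x∈p-y y∈B (∈H⇒≢u y∈H)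
    size : ∣ (B ∩ H) ∪ ⁅ w ⁆ ∣ ≤ ∣ B ∣
    size = begin
      ∣ (B ∩ H) ∪ ⁅ w ⁆ ∣  ≤⟨ ∣p∪⁅x⁆∣≤1+∣p∣ (B ∩ H) w ⟩
      suc ∣ B ∩ H ∣        ≤⟨ s≤s (p⊆q⇒∣p∣≤∣q∣ B∩H⊆B-u) ⟩
      suc ∣ B - u ∣        ≤⟨ x∈p⇒∣p-x∣<∣p∣ u∈B ⟩
      ∣ B ∣                ∎

SkewZ≡-transfer : {G : Graph n} {W V : Subset n} →
  (∀ {B} → IsSkewZFS G V B → IsSkewZFS G W B) →
  (∀ {B} → IsSkewZFS G W B → Σ (Subset n) λ B' → IsSkewZFS G V B' × ∣ B' ∣ ≤ ∣ B ∣) →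
  ∀ k → SkewZ≡ G W k ⇔ SkewZ≡ G V k
SkewZ≡-transfer {G = G} {W} {V} lift restrict k = mk⇔ to from
  where
  to : SkewZ≡ G W k → SkewZ≡ G V k
  to ((B , zfs , ∣B∣≡k) , minimal) with restrict zfs
  ... | B' , zfs' , ∣B'∣≤∣B∣ =
    (B' , zfs' , ≤-antisym (subst (∣ B' ∣ ≤_) ∣B∣≡k ∣B'∣≤∣B∣) (minimal B' (lift zfs'))) ,
    λ C zfs-C → minimal C (lift zfs-C)
  from : SkewZ≡ G V k → SkewZ≡ G W k
  from ((B , zfs , ∣B∣≡k) , minimal) =
    (B , lift zfs , ∣B∣≡k) ,
    λ C zfs-C → let (C' , zfs' , ∣C'∣≤∣C∣) = restrict zfs-C in ≤-trans (minimal C' zfs') ∣C'∣≤∣C∣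

SkewZ≡-leafStep : (G : Graph n) {W W' : Subset n} → LeafStep G W W' →
                  ∀ k → SkewZ≡ G W k ⇔ SkewZ≡ G W' k
SkewZ≡-leafStep G (u , v , leaf , refl) = SkewZ≡-transfer skewZFS-lift skewZFS-restrict
  where open LeafDeletion G leaf

SkewZ≡-leafSteps : (G : Graph n) {W W' : Subset n} → Star (LeafStep G) W W' →
                   ∀ k → SkewZ≡ G W k ⇔ SkewZ≡ G W' k
SkewZ≡-leafSteps G = Star.fold (λ W W' → ∀ k → SkewZ≡ G W k ⇔ SkewZ≡ G W' k)
  (λ step rest k → ⇔.trans (SkewZ≡-leafStep G step k) (rest k))
  (λ k → ⇔.refl)

Colours-from-∅⇒HasLeaf : {G : Graph n} {W B : Subset n} →
  ∣ B ∣ ≡ 0 → Colours G W B → Nonempty W → HasLeaf G W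
Colours-from-∅⇒HasLeaf ∣B∣≡0 (done W⊆B) (x , x∈W) = ⊥-elim (∣p∣≡0⇒x∉p ∣B∣≡0 (W⊆B x∈W))
Colours-from-∅⇒HasLeaf ∣B∣≡0 (force x w (x∈W , w∈W , x~w , _ , sole)  _) _ =
  x , w , x∈W , w∈W , x~w , λ y y∈W x~y → sole y y∈W x~y (∣p∣≡0⇒x∉p ∣B∣≡0)

SkewZ≡0⇔Empty : (G : Graph n) {W : Subset n} → ¬ HasLeaf G W → SkewZ≡ G W 0 ⇔ Empty W
SkewZ≡0⇔Empty {n} G {W} leafless = mk⇔ to from
  where
  to : SkewZ≡ G W 0 → Empty W
  to ((B , (_ , colours) , ∣B∣≡0) , _) nonempty =
    leafless (Colours-from-∅⇒HasLeaf ∣B∣≡0 colours nonempty)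
  from : Empty W → SkewZ≡ G W 0
  from empty = (⊥ , ((λ x∈⊥ → ⊥-elim (∉⊥ x∈⊥)) , done (λ x∈W → ⊥-elim (empty (_ , x∈W)))) ,
                ∣⊥∣≡0 n) ,
               λ _ _ → z≤n

theorem3p22 : ∀ {n} (G : Graph n) (Ĝ : Subset n) →
    Star (LeafStep G) ⊤ Ĝ → ¬ HasLeaf G Ĝ →
    ((k : ℕ) → SkewZ≡ G ⊤ k ⇔ SkewZ≡ G Ĝ k) × (SkewZ≡ G ⊤ 0 ⇔ Empty Ĝ)
theorem3p22 G Ĝ steps leafless =
  SkewZ≡-leafSteps G steps , ⇔.trans (SkewZ≡-leafSteps G steps 0) (SkewZ≡0⇔Empty G leafless)
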